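{- Every $n$-vertex $C_4$-free graph $G$ (with $n\ge 1$) has an independent set of size at least $\frac{n}{3+\sqrt{n}}$.
   Context: All graphs are finite, simple and loopless. $C_4$-free means no subgraph isomorphic to the cycle on four vertices. -}

module Defs where

open import Data.Nat using (ℕ; _≤_; _*_; _∸_; _^_)
open import Data.Fin using (Fin)
open import Data.Fin.Subset using (Subset; _∈_; ∣_∣)
open import Data.Bool using (Bool; true; false)
open import Data.Product using (Σ; _×_; ∃)
open import Relation.Binary.PropositionalEquality using (_≡_; _≢_)

record Graph (n : ℕ) : Set where
  field
    adj       : Fin n → Fin n → Bool
    symmetric : ∀ i j → adj i j ≡ adj j i
    loopless  : ∀ i → adj i i ≡ false
open Graph public

HasC4 : ∀ {n} → Graph n → Set
HasC4 {n} G = Σ (Fin n) λ a → Σ (Fin n) λ b → Σ (Fin n) λ c → Σ (Fin n) λ d →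
  (a ≢ b) × (a ≢ c) × (a ≢ d) × (b ≢ c) × (b ≢ d) × (c ≢ d) ×
  (adj G a b ≡ true) × (adj G b c ≡ true) × (adj G c d ≡ true) × (adj G d a ≡ true)

C4Free : ∀ {n} → Graph n → Set
C4Free G = HasC4 G → Data.Empty.⊥
  where import Data.Empty

Independent : ∀ {n} → Graph n → Subset n → Set
Independent {n} G S = ∀ (i j : Fin n) → i ∈ S → j ∈ S → adj G i j ≡ false

-- For naturals k, n: k ≥ n / (3 + √n)  ⇔  k·√n ≥ n − 3k
--   ⇔  n ≤ 3k  or  (n − 3k)² ≤ k²·n,  i.e. (with truncated subtraction)
--   (n ∸ 3k)² ≤ k·k·n.
AtLeastBound : ℕ → ℕ → Set
AtLeastBound n k = (n ∸ 3 * k) ^ 2 ≤ k * k * n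

-- Greedy algorithm: while vertices remain, pick a vertex v of minimum degree d in the
-- subgraph induced by the remaining set R, put v into S and delete v together with
-- its neighbours. Among the paths v – u – w in R, each neighbour u of v starts at
-- least d, while C4-freeness lets each w ≠ v end at most one; hence d² ≤ d + |R|,
-- so d ≤ 2 + √|R| and a step deletes at most 3 + √|R| vertices. In the squared form
-- (n ∸ 3k)² ≤ k²n of k ≥ n / (3 + √n), this is exactly what lets the bound for the
-- rest of R pass to R with one more vertex in S.

module Submission where

open import Data.Bool using (true; false; _∧_; if_then_else_)
open import Data.Bool.Properties using (¬-not)
open import Data.Empty using (⊥-elim)
open import Data.Fin using (Fin; zero; suc; punchIn)
import Data.Fin.Properties as Finₚ
open import Data.Fin.Subset
  using (Subset; ∣_∣; _∈_; _∉_; _⊆_; _∩_; _∪_; _─_; _-_; ⁅_⁆; ⊤; ⊥; Nonempty; Empty; inside; outside)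
open import Data.Fin.Subset.Properties
open import Data.Nat hiding (∣_-_∣)
open import Data.Nat.Induction using (<-wellFounded)
open import Data.Nat.Properties
open import Algebra.Properties.Semiring.Sum +-*-semiring
  using (sum; sum-cong-≗; ∑-comm; *-distribˡ-sum; *-distribʳ-sum; sum-remove)
open import Algebra.Properties.CommutativeSemigroup *-commutativeSemigroup using (x∙yz≈y∙xz)
open import Data.Nat.Tactic.RingSolver using (solve-∀)
open import Data.Product using (Σ; ∃; _×_; _,_)
open import Data.Sum using (inj₁; inj₂)
open import Data.Vec using ([]; _∷_; here; there; lookup; tabulate)
open import Data.Vec.Functional using (Vector; removeAt)
open import Data.Vec.Properties using (lookup∘tabulate; lookup-zipWith; []=⇒lookup; lookup⇒[]=)
open import Function using (_∘_)
open import Induction.WellFounded using (Acc; acc)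
open import Relation.Binary.PropositionalEquality
open import Relation.Nullary using (yes; no; contradiction; _×-dec_)

open import Defs

m^2≡m*m : ∀ m → m ^ 2 ≡ m * m
m^2≡m*m m = cong (m *_) (*-identityʳ m)

m*m≤n*n⇒m≤n : ∀ {m n} → m * m ≤ n * n → m ≤ n
m*m≤n*n⇒m≤n m²≤n² = ≮⇒≥ (λ n<m → <⇒≱ (*-mono-< n<m n<m) m²≤n²)

[x+y]²≡x²+2xy+y² : ∀ x y → (x + y) * (x + y) ≡ x * x + 2 * (x * y) + y * y
[x+y]²≡x²+2xy+y² = solve-∀

a²r+2abr+b²r≡[a+b]²r : ∀ a b r → a * a * r + 2 * (a * b * r) + b * b * r ≡ (a + b) * (a + b) * r
a²r+2abr+b²r≡[a+b]²r = solve-∀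

[xy]²≡x²y² : ∀ x y → x * y * (x * y) ≡ x * x * (y * y)
[xy]²≡x²y² = solve-∀

a²r*b²r≡[abr]² : ∀ a b r → a * a * r * (b * b * r) ≡ a * b * r * (a * b * r)
a²r*b²r≡[abr]² = solve-∀

-- In terms of square roots: x ≤ a√r and y ≤ b√r give x + y ≤ (a + b)√r.
[x+y]²≤[a+b]²r : ∀ {x y a b r} → x * x ≤ a * a * r → y * y ≤ b * b * r →
                 (x + y) * (x + y) ≤ (a + b) * (a + b) * r
[x+y]²≤[a+b]²r {x} {y} {a} {b} {r} x²≤a²r y²≤b²r = begin
  (x + y) * (x + y)                       ≡⟨ [x+y]²≡x²+2xy+y² x y ⟩
  x * x + 2 * (x * y) + y * y             ≤⟨ +-mono-≤ (+-mono-≤ x²≤a²r (*-monoʳ-≤ 2 xy≤abr)) y²≤b²r ⟩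
  a * a * r + 2 * (a * b * r) + b * b * r ≡⟨ a²r+2abr+b²r≡[a+b]²r a b r ⟩
  (a + b) * (a + b) * r                   ∎
  where
  open ≤-Reasoning
  xy≤abr : x * y ≤ a * b * r
  xy≤abr = m*m≤n*n⇒m≤n (begin
    x * y * (x * y)           ≡⟨ [xy]²≡x²y² x y ⟩
    x * x * (y * y)           ≤⟨ *-mono-≤ x²≤a²r y²≤b²r ⟩
    a * a * r * (b * b * r)   ≡⟨ a²r*b²r≡[abr]² a b r ⟩
    a * b * r * (a * b * r)   ∎)

2+e+[e²+[3e+2]]≡[2+e]² : ∀ e → 2 + e + (e * e + (3 * e + 2)) ≡ (2 + e) * (2 + e)
2+e+[e²+[3e+2]]≡[2+e]² = solve-∀

[d∸2]²≤r : ∀ d r → d * d ≤ d + r → (d ∸ 2) * (d ∸ 2) ≤ r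
[d∸2]²≤r 0 r _ = z≤n
[d∸2]²≤r 1 r _ = z≤n
[d∸2]²≤r (suc (suc e)) r d²≤d+r = +-cancelˡ-≤ (2 + e) (e * e) r (begin
  2 + e + e * e                   ≤⟨ +-monoʳ-≤ (2 + e) (m≤m+n (e * e) (3 * e + 2)) ⟩
  2 + e + (e * e + (3 * e + 2))   ≡⟨ 2+e+[e²+[3e+2]]≡[2+e]² e ⟩
  (2 + e) * (2 + e)               ≤⟨ d²≤d+r ⟩
  2 + e + r                       ∎)
  where open ≤-Reasoning

AtLeastBound-zero : ∀ k → AtLeastBound 0 k
AtLeastBound-zero k rewrite 0∸n≡0 (3 * k) = z≤n

AtLeastBound-mono : ∀ {n k l} → k ≤ l → AtLeastBound n k → AtLeastBound n l
AtLeastBound-mono {n} {k} {l} k≤l bound = begin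
  (n ∸ 3 * l) ^ 2  ≤⟨ ^-monoˡ-≤ 2 (∸-monoʳ-≤ n (*-monoʳ-≤ 3 k≤l)) ⟩
  (n ∸ 3 * k) ^ 2  ≤⟨ bound ⟩
  k * k * n        ≤⟨ *-monoˡ-≤ n (*-mono-≤ k≤l k≤l) ⟩
  l * l * n        ∎
  where open ≤-Reasoning

3k+y+1+[2+z]≡3[1+k]+[y+z] : ∀ k y z → 3 * k + y + 1 + (2 + z) ≡ 3 * suc k + (y + z)
3k+y+1+[2+z]≡3[1+k]+[y+z] = solve-∀

AtLeastBound-step : ∀ {a r d k} → a ≤ r → r ≤ a + 1 + d → d * d ≤ d + r →
                    AtLeastBound a k → AtLeastBound r (suc k)
AtLeastBound-step {a} {r} {d} {k} a≤r r≤a+1+d d²≤d+r [a∸3k]²≤k²a = begin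
  (r ∸ 3 * suc k) ^ 2     ≡⟨ m^2≡m*m (r ∸ 3 * suc k) ⟩
  (r ∸ 3 * suc k) * (r ∸ 3 * suc k)
                          ≤⟨ *-mono-≤ r∸3[1+k]≤y+z r∸3[1+k]≤y+z ⟩
  (y + z) * (y + z)       ≤⟨ [x+y]²≤[a+b]²r {y} {z} {k} {1} y²≤k²r z²≤1²r ⟩
  (k + 1) * (k + 1) * r   ≡⟨ cong (λ m → m * m * r) (+-comm k 1) ⟩
  suc k * suc k * r       ∎
  where
  open ≤-Reasoning
  y = a ∸ 3 * k
  z = d ∸ 2
  y²≤k²r : y * y ≤ k * k * r
  y²≤k²r = ≤-trans (subst (_≤ k * k * a) (m^2≡m*m y) [a∸3k]²≤k²a) (*-monoʳ-≤ (k * k) a≤r)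
  z²≤1²r : z * z ≤ 1 * 1 * r
  z²≤1²r = subst (z * z ≤_) (sym (*-identityˡ r)) ([d∸2]²≤r d r d²≤d+r)
  r∸3[1+k]≤y+z : r ∸ 3 * suc k ≤ y + z
  r∸3[1+k]≤y+z = m≤n+o⇒m∸n≤o r (3 * suc k) (begin
    r                         ≤⟨ r≤a+1+d ⟩
    a + 1 + d                 ≤⟨ +-mono-≤ (+-monoˡ-≤ 1 (m≤n+m∸n a (3 * k))) (m≤n+m∸n d 2) ⟩
    3 * k + y + 1 + (2 + z)   ≡⟨ 3k+y+1+[2+z]≡3[1+k]+[y+z] k y z ⟩
    3 * suc k + (y + z)       ∎)

∑-mono-≤ : ∀ {n} {f g : Vector ℕ n} → (∀ i → f i ≤ g i) → sum f ≤ sum g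
∑-mono-≤ {zero}  _   = z≤n
∑-mono-≤ {suc n} f≤g = +-mono-≤ (f≤g zero) (∑-mono-≤ (f≤g ∘ suc))

sum≤point+sum : ∀ {n} (f g : Vector ℕ n) (v : Fin n) →
                (∀ w → w ≢ v → f w ≤ g w) → sum f ≤ f v + sum g
sum≤point+sum {suc n} f g v f≤g = begin
  sum f                             ≡⟨ sum-remove {i = v} f ⟩
  f v + sum (removeAt f v)          ≤⟨ +-monoʳ-≤ (f v) (∑-mono-≤ removeAt-f≤g) ⟩
  f v + sum (removeAt g v)          ≤⟨ +-monoʳ-≤ (f v) (m≤n+m _ (g v)) ⟩
  f v + (g v + sum (removeAt g v))  ≡⟨ cong (f v +_) (sum-remove {i = v} g) ⟨
  f v + sum g                       ∎
  where
  open ≤-Reasoning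
  removeAt-f≤g : ∀ j → removeAt f v j ≤ removeAt g v j
  removeAt-f≤g j = f≤g (punchIn v j) (Finₚ.punchInᵢ≢i v j)

χ : ∀ {n} → Subset n → Vector ℕ n
χ p i = if lookup p i then 1 else 0

∣p∣≡∑χ : ∀ {n} (p : Subset n) → ∣ p ∣ ≡ sum (χ p)
∣p∣≡∑χ []            = refl
∣p∣≡∑χ (inside  ∷ p) = cong suc (∣p∣≡∑χ p)
∣p∣≡∑χ (outside ∷ p) = ∣p∣≡∑χ p

χ-∩ : ∀ {n} (p q : Subset n) i → χ (p ∩ q) i ≡ χ p i * χ q i
χ-∩ p q i rewrite lookup-zipWith _∧_ i p q with lookup p i
... | true  = sym (*-identityˡ _)
... | false = refl

χ*≤ : ∀ {n} (p : Subset n) i m → χ p i * m ≤ m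
χ*≤ p i m with lookup p i
... | true  = ≤-reflexive (*-identityˡ m)
... | false = z≤n

χ*-monoʳ-≤ : ∀ {n} (p : Subset n) i {m o} → (i ∈ p → m ≤ o) → χ p i * m ≤ χ p i * o
χ*-monoʳ-≤ p i m≤o with lookup p i in i∈p
... | true  = *-monoʳ-≤ 1 (m≤o (lookup⇒[]= i p i∈p))
... | false = z≤n

∣p∣≡∣p─q∣+∣p∩q∣ : ∀ {n} (p q : Subset n) → ∣ p ∣ ≡ ∣ p ─ q ∣ + ∣ p ∩ q ∣
∣p∣≡∣p─q∣+∣p∩q∣ []            []            = refl
∣p∣≡∣p─q∣+∣p∩q∣ (outside ∷ p) (outside ∷ q) = ∣p∣≡∣p─q∣+∣p∩q∣ p q
∣p∣≡∣p─q∣+∣p∩q∣ (outside ∷ p) (inside  ∷ q) = ∣p∣≡∣p─q∣+∣p∩q∣ p q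
∣p∣≡∣p─q∣+∣p∩q∣ (inside  ∷ p) (outside ∷ q) = cong suc (∣p∣≡∣p─q∣+∣p∩q∣ p q)
∣p∣≡∣p─q∣+∣p∩q∣ (inside  ∷ p) (inside  ∷ q) =
  trans (cong suc (∣p∣≡∣p─q∣+∣p∩q∣ p q)) (sym (+-suc _ _))

x∈p─q⇒x∉q : ∀ {n} {x : Fin n} (p q : Subset n) → x ∈ p ─ q → x ∉ q
x∈p─q⇒x∉q (_ ∷ p) (outside ∷ q) here         ()
x∈p─q⇒x∉q (_ ∷ p) (_       ∷ q) (there x∈p─q) (there x∈q) = x∈p─q⇒x∉q p q x∈p─q x∈q

subsingleton⇒∣p∣≤1 : ∀ {n} (p : Subset n) → (∀ {x y} → x ∈ p → y ∈ p → x ≡ y) → ∣ p ∣ ≤ 1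
subsingleton⇒∣p∣≤1 []            _      = z≤n
subsingleton⇒∣p∣≤1 (outside ∷ p) unique =
  subsingleton⇒∣p∣≤1 p (λ x∈p y∈p → Finₚ.suc-injective (unique (there x∈p) (there y∈p)))
subsingleton⇒∣p∣≤1 {suc n} (inside  ∷ p) unique = s≤s (≤-reflexive (begin
  ∣ p ∣           ≡⟨ cong ∣_∣ (Empty-unique (λ (_ , x∈p) → Finₚ.0≢1+n (unique here (there x∈p)))) ⟩
  ∣ ⊥ {n = n} ∣  ≡⟨ ∣⊥∣≡0 n ⟩
  0               ∎))
  where open ≡-Reasoning

minimiser : ∀ {n} (f : Fin n → ℕ) {p : Subset n} → Nonempty p →
            ∃ λ v → v ∈ p × (∀ {u} → u ∈ p → f v ≤ f u)
minimiser f {p} (x , x∈p) = descend x∈p (<-wellFounded (f x))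
  where
  descend : ∀ {x} → x ∈ p → Acc _<_ (f x) → ∃ λ v → v ∈ p × (∀ {u} → u ∈ p → f v ≤ f u)
  descend {x} x∈p (acc smaller) with Finₚ.any? (λ u → u ∈? p ×-dec f u <? f x)
  ... | yes (u , u∈p , fu<fx) = descend u∈p (smaller fu<fx)
  ... | no  ∄u                = x , x∈p , λ u∈p → ≮⇒≥ (λ fu<fx → ∄u (_ , u∈p , fu<fx))

module _ {n : ℕ} (G : Graph n) where

  N : Fin n → Subset n
  N v = tabulate (adj G v)

  deg : Subset n → Fin n → ℕ
  deg R v = ∣ R ∩ N v ∣

  _─N[_] : Subset n → Fin n → Subset n
  R ─N[ v ] = R ─ N v - v

  ∈N⁺ : ∀ {u v} → adj G v u ≡ true → u ∈ N v
  ∈N⁺ {u} {v} vu = lookup⇒[]= u (N v) (trans (lookup∘tabulate (adj G v) u) vu)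

  ∈N⁻ : ∀ {u v} → u ∈ N v → adj G v u ≡ true
  ∈N⁻ {u} {v} u∈Nv = trans (sym (lookup∘tabulate (adj G v) u)) ([]=⇒lookup u∈Nv)

  ∉N⁻ : ∀ {u v} → u ∉ N v → adj G v u ≡ false
  ∉N⁻ u∉Nv = ¬-not (u∉Nv ∘ ∈N⁺)

  v∉N[v] : ∀ v → v ∉ N v
  v∉N[v] v v∈Nv = contradiction (trans (sym (∈N⁻ v∈Nv)) (loopless G v)) λ ()

  adjacent⇒≢ : ∀ {u v} → adj G u v ≡ true → u ≢ v
  adjacent⇒≢ uv refl = v∉N[v] _ (∈N⁺ uv)

  χN-sym : ∀ u w → χ (N u) w ≡ χ (N w) u
  χN-sym u w = cong (λ b → if b then 1 else 0) (begin
    lookup (N u) w  ≡⟨ lookup∘tabulate (adj G u) w ⟩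
    adj G u w       ≡⟨ symmetric G u w ⟩
    adj G w u       ≡⟨ lookup∘tabulate (adj G w) u ⟨
    lookup (N w) u  ∎)
    where open ≡-Reasoning

  -- Both sides count the adjacent pairs (u , w) with u ∈ A and w ∈ R.
  ∑χ-deg-swap : ∀ A R → sum (λ u → χ A u * deg R u) ≡ sum (λ w → χ R w * deg A w)
  ∑χ-deg-swap A R = begin
    sum (λ u → χ A u * ∣ R ∩ N u ∣)
      ≡⟨ sum-cong-≗ (λ u → cong (χ A u *_) (∣p∣≡∑χ (R ∩ N u))) ⟩
    sum (λ u → χ A u * sum (χ (R ∩ N u)))
      ≡⟨ sum-cong-≗ (λ u → *-distribˡ-sum (χ A u) (χ (R ∩ N u))) ⟩
    sum (λ u → sum (λ w → χ A u * χ (R ∩ N u) w))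
      ≡⟨ ∑-comm (λ u w → χ A u * χ (R ∩ N u) w) ⟩
    sum (λ w → sum (λ u → χ A u * χ (R ∩ N u) w))
      ≡⟨ sum-cong-≗ (λ w → sum-cong-≗ (λ u → edge u w)) ⟩
    sum (λ w → sum (λ u → χ R w * χ (A ∩ N w) u))
      ≡⟨ sum-cong-≗ (λ w → *-distribˡ-sum (χ R w) (χ (A ∩ N w))) ⟨
    sum (λ w → χ R w * sum (χ (A ∩ N w)))
      ≡⟨ sum-cong-≗ (λ w → cong (χ R w *_) (∣p∣≡∑χ (A ∩ N w))) ⟨
    sum (λ w → χ R w * ∣ A ∩ N w ∣)
      ∎
    where
    open ≡-Reasoning
    edge : ∀ u w → χ A u * χ (R ∩ N u) w ≡ χ R w * χ (A ∩ N w) u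
    edge u w rewrite χ-∩ R (N u) w | χ-∩ A (N w) u | χN-sym u w =
      x∙yz≈y∙xz (χ A u) (χ R w) (χ (N w) u)

  BigIndependentSubset : Subset n → Set
  BigIndependentSubset R = Σ (Subset n) λ S → S ⊆ R × Independent G S × AtLeastBound ∣ R ∣ ∣ S ∣

  empty-bigIndependentSubset : ∀ {R} → Empty R → BigIndependentSubset R
  empty-bigIndependentSubset {R} R-empty =
    ⊥ , ⊥⊆ , (λ _ _ i∈⊥ → contradiction i∈⊥ ∉⊥) ,
    subst (λ r → AtLeastBound r ∣ ⊥ {n = n} ∣) (sym ∣R∣≡0) (AtLeastBound-zero ∣ ⊥ {n = n} ∣)
    where
    ∣R∣≡0 : ∣ R ∣ ≡ 0
    ∣R∣≡0 = trans (cong ∣_∣ (Empty-unique R-empty)) (∣⊥∣≡0 n)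

  ∣R─N[v]∣<∣R∣ : ∀ {R v} → v ∈ R → ∣ R ─N[ v ] ∣ < ∣ R ∣
  ∣R─N[v]∣<∣R∣ {R} {v} v∈R =
    ≤-trans (x∈p⇒∣p-x∣<∣p∣ (x∈p∧x∉q⇒x∈p─q v∈R (v∉N[v] v))) (∣p─q∣≤∣p∣ R (N v))

  ∣R∣≤∣R─N[v]∣+1+deg : ∀ R v → ∣ R ∣ ≤ ∣ R ─N[ v ] ∣ + 1 + deg R v
  ∣R∣≤∣R─N[v]∣+1+deg R v = begin
    ∣ R ∣                                     ≡⟨ ∣p∣≡∣p─q∣+∣p∩q∣ R (N v) ⟩
    ∣ R ─ N v ∣ + deg R v                     ≡⟨ cong (_+ deg R v) (∣p∣≡∣p─q∣+∣p∩q∣ (R ─ N v) ⁅ v ⁆) ⟩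
    ∣ R ─ N v - v ∣ + ∣ (R ─ N v) ∩ ⁅ v ⁆ ∣ + deg R v
                                              ≤⟨ +-monoˡ-≤ (deg R v) (+-monoʳ-≤ ∣ R ─ N v - v ∣ ∣R─N∩v∣≤1) ⟩
    ∣ R ─ N v - v ∣ + 1 + deg R v             ∎
    where
    open ≤-Reasoning
    ∣R─N∩v∣≤1 : ∣ (R ─ N v) ∩ ⁅ v ⁆ ∣ ≤ 1
    ∣R─N∩v∣≤1 = ≤-trans (∣p∩q∣≤∣q∣ (R ─ N v) ⁅ v ⁆) (≤-reflexive (∣⁅x⁆∣≡1 v))

  module _ (C4-free : C4Free G) where

    common-neighbour-unique : ∀ {v w u₁ u₂} → v ≢ w →
      u₁ ∈ N v → u₁ ∈ N w → u₂ ∈ N v → u₂ ∈ N w → u₁ ≡ u₂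
    common-neighbour-unique {v} {w} {u₁} {u₂} v≢w u₁∈Nv u₁∈Nw u₂∈Nv u₂∈Nw with u₁ Finₚ.≟ u₂
    ... | yes u₁≡u₂ = u₁≡u₂
    ... | no  u₁≢u₂ = ⊥-elim (C4-free (v , u₁ , w , u₂ ,
          adjacent⇒≢ vu₁ , v≢w , adjacent⇒≢ vu₂ , adjacent⇒≢ u₁w , u₁≢u₂ , adjacent⇒≢ wu₂ ,
          vu₁ , u₁w , wu₂ , u₂v))
      where
      vu₁ = ∈N⁻ u₁∈Nv
      vu₂ = ∈N⁻ u₂∈Nv
      wu₂ = ∈N⁻ u₂∈Nw
      u₁w = trans (symmetric G u₁ w) (∈N⁻ u₁∈Nw)
      u₂v = trans (symmetric G u₂ v) vu₂

    deg[p∩N]≤1 : ∀ {v w} (p : Subset n) → v ≢ w → deg (p ∩ N v) w ≤ 1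
    deg[p∩N]≤1 {v} {w} p v≢w = subsingleton⇒∣p∣≤1 ((p ∩ N v) ∩ N w) λ x∈ y∈ →
      let x∈p∩Nv , x∈Nw = x∈p∩q⁻ (p ∩ N v) (N w) x∈
          y∈p∩Nv , y∈Nw = x∈p∩q⁻ (p ∩ N v) (N w) y∈
      in common-neighbour-unique v≢w (p∩q⊆q p (N v) x∈p∩Nv) x∈Nw (p∩q⊆q p (N v) y∈p∩Nv) y∈Nw

    min-deg²≤min-deg+∣R∣ : ∀ {R v} → (∀ {u} → u ∈ R → deg R v ≤ deg R u) →
                           deg R v * deg R v ≤ deg R v + ∣ R ∣
    min-deg²≤min-deg+∣R∣ {R} {v} minimal = begin
      d * d                                 ≡⟨ cong (_* d) (∣p∣≡∑χ A) ⟩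
      sum (χ A) * d                         ≡⟨ *-distribʳ-sum d (χ A) ⟩
      sum (λ u → χ A u * d)                 ≤⟨ ∑-mono-≤ (λ u → χ*-monoʳ-≤ A u (minimal ∘ p∩q⊆p R (N v))) ⟩
      sum (λ u → χ A u * deg R u)           ≡⟨ ∑χ-deg-swap A R ⟩
      sum (λ w → χ R w * deg A w)           ≤⟨ sum≤point+sum _ (χ R) v χ*deg≤χ ⟩
      χ R v * deg A v + sum (χ R)           ≤⟨ +-mono-≤ (χ*≤ R v (deg A v)) (≤-reflexive (sym (∣p∣≡∑χ R))) ⟩
      deg A v + ∣ R ∣                       ≤⟨ +-monoˡ-≤ ∣ R ∣ (∣p∩q∣≤∣p∣ A (N v)) ⟩
      d + ∣ R ∣                             ∎
      where
      open ≤-Reasoning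
      A = R ∩ N v
      d = deg R v
      χ*deg≤χ : ∀ w → w ≢ v → χ R w * deg A w ≤ χ R w
      χ*deg≤χ w w≢v =
        ≤-trans (*-monoʳ-≤ (χ R w) (deg[p∩N]≤1 R (w≢v ∘ sym))) (≤-reflexive (*-identityʳ (χ R w)))

    add-min-degree-vertex : ∀ {R v} → v ∈ R → (∀ {u} → u ∈ R → deg R v ≤ deg R u) →
                            BigIndependentSubset (R ─N[ v ]) → BigIndependentSubset R
    add-min-degree-vertex {R} {v} v∈R minimal (S , S⊆R' , S-indep , bound) =
      S ∪ ⁅ v ⁆ , S∪v⊆R , S∪v-indep ,
      AtLeastBound-mono ∣S∣<∣S∪v∣
        (AtLeastBound-step (<⇒≤ (∣R─N[v]∣<∣R∣ v∈R)) (∣R∣≤∣R─N[v]∣+1+deg R v)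
                           (min-deg²≤min-deg+∣R∣ minimal) bound)
      where
      S⊆R─N : S ⊆ R ─ N v
      S⊆R─N = p─q⊆p (R ─ N v) ⁅ v ⁆ ∘ S⊆R'
      v≁S : ∀ {u} → u ∈ S → adj G v u ≡ false
      v≁S u∈S = ∉N⁻ (x∈p─q⇒x∉q R (N v) (S⊆R─N u∈S))
      v∉S : v ∉ S
      v∉S v∈S = x∈p─q⇒x∉q (R ─ N v) ⁅ v ⁆ (S⊆R' v∈S) (x∈⁅x⁆ v)
      S∪v⊆R : S ∪ ⁅ v ⁆ ⊆ R
      S∪v⊆R u∈ with x∈p∪q⁻ S ⁅ v ⁆ u∈
      ... | inj₁ u∈S = p─q⊆p R (N v) (S⊆R─N u∈S)
      ... | inj₂ u∈v rewrite x∈⁅y⁆⇒x≡y v u∈v = v∈R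
      S∪v-indep : Independent G (S ∪ ⁅ v ⁆)
      S∪v-indep i j i∈ j∈ with x∈p∪q⁻ S ⁅ v ⁆ i∈ | x∈p∪q⁻ S ⁅ v ⁆ j∈
      ... | inj₁ i∈S | inj₁ j∈S = S-indep i j i∈S j∈S
      ... | inj₁ i∈S | inj₂ j∈v rewrite x∈⁅y⁆⇒x≡y v j∈v = trans (symmetric G i v) (v≁S i∈S)
      ... | inj₂ i∈v | inj₁ j∈S rewrite x∈⁅y⁆⇒x≡y v i∈v = v≁S j∈S
      ... | inj₂ i∈v | inj₂ j∈v rewrite x∈⁅y⁆⇒x≡y v i∈v | x∈⁅y⁆⇒x≡y v j∈v = loopless G v
      ∣S∣<∣S∪v∣ : ∣ S ∣ < ∣ S ∪ ⁅ v ⁆ ∣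
      ∣S∣<∣S∪v∣ = p⊂q⇒∣p∣<∣q∣ (p⊆p∪q ⁅ v ⁆ , v , x∈p∪q⁺ (inj₂ (x∈⁅x⁆ v)) , v∉S)

    greedy : ∀ R → Acc _<_ ∣ R ∣ → BigIndependentSubset R
    greedy R (acc smaller) with nonempty? R
    ... | no  R-empty    = empty-bigIndependentSubset R-empty
    ... | yes R-nonempty =
      let v , v∈R , minimal = minimiser (deg R) R-nonempty
      in add-min-degree-vertex v∈R minimal (greedy (R ─N[ v ]) (smaller (∣R─N[v]∣<∣R∣ v∈R)))

proposition6p8 : (n : ℕ) → n ≥ 1 → (G : Graph n) → C4Free G →
    Σ (Subset n) λ S → Independent G S × AtLeastBound n ∣ S ∣
proposition6p8 n _ G C4-free =
  let S , _ , S-indep , bound = greedy G C4-free ⊤ (<-wellFounded _)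
  in S , S-indep , subst (λ r → AtLeastBound r ∣ S ∣) (∣⊤∣≡n n) bound
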